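{- Let $N$ be a positive integer and $g=\begin{pmatrix}a&b\\c&d\end{pmatrix}\in\mathrm{SL}_2(\mathbb{Z})$. Then $$\Gamma_1(N)/(\Gamma_1(N)\cap g^{ -1}\Gamma_1(N)g)\cong\big(\Gamma_1(N)/\Gamma(N)\big)\big/\big((\Gamma_1(N)\cap g^{ -1}\Gamma_1(N)g)/\Gamma(N)\big),$$ $\Gamma_1(N)/\Gamma(N)=T^{\mathbb{Z}}\Gamma(N)$, and $(\Gamma_1(N)\cap g^{ -1}\Gamma_1(N)g)/\Gamma(N)=T^{n_g\mathbb{Z}}\Gamma(N)$, where $$n_g=\mathrm{lcm}\Big(\frac{N}{\gcd(N,ac)},\frac{N}{\gcd(N,c^2)}\Big)$$ and $T=\begin{pmatrix}1&1\\0&1\end{pmatrix}$.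
   Context: $\Gamma(N)$ and $\Gamma_1(N)$ are the standard congruence subgroups of $\mathrm{SL}_2(\mathbb{Z})$ ($\Gamma_1(N)$: matrices congruent to $\begin{pmatrix}1&*\\0&1\end{pmatrix}$ modulo $N$). A set of the form $T^{m\mathbb{Z}}\Gamma(N)$ is viewed as the subgroup of $\Gamma_1(N)/\Gamma(N)$ generated by the image of $T^m$. -}

module Defs where

open import Data.Nat as ℕ using (ℕ; NonZero; ≢-nonZero; ≢-nonZero⁻¹)
open import Data.Nat.GCD using (gcd; gcd[m,n]≢0)
open import Data.Nat.LCM using (lcm)
open import Data.Nat.DivMod using (_/_)
open import Data.Integer as ℤ using (ℤ; +_; -[1+_]; _+_; _-_; _*_; -_; ∣_∣)
open import Data.Integer.Divisibility using (_∣_)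
open import Data.Product using (_×_)
open import Data.Sum using (inj₁)
open import Relation.Binary.PropositionalEquality using (_≡_)

record M2 : Set where
  constructor mat
  field
    a b c d : ℤ
open M2 public

_⊗_ : M2 → M2 → M2
mat a₁ b₁ c₁ d₁ ⊗ mat a₂ b₂ c₂ d₂ =
  mat (a₁ * a₂ + b₁ * c₂) (a₁ * b₂ + b₁ * d₂)
      (c₁ * a₂ + d₁ * c₂) (c₁ * b₂ + d₁ * d₂)
infixl 7 _⊗_

det : M2 → ℤ
det (mat a b c d) = a * d - b * c

SL2 : M2 → Set
SL2 m = det m ≡ + 1

inv : M2 → M2
inv (mat a b c d) = mat d (- b) (- c) a

I₂ : M2
I₂ = mat (+ 1) (+ 0) (+ 0) (+ 1)

T : M2
T = mat (+ 1) (+ 1) (+ 0) (+ 1)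

T⁻¹ : M2
T⁻¹ = inv T

pow : M2 → ℕ → M2
pow m ℕ.zero = I₂
pow m (ℕ.suc n) = m ⊗ pow m n

T^ : ℤ → M2
T^ (+ n) = pow T n
T^ -[1+ n ] = pow T⁻¹ (ℕ.suc n)

InΓ : ℕ → M2 → Set
InΓ N m = SL2 m × ((+ N) ∣ (a m - + 1)) × ((+ N) ∣ b m) × ((+ N) ∣ c m) × ((+ N) ∣ (d m - + 1))

InΓ₁ : ℕ → M2 → Set
InΓ₁ N m = SL2 m × ((+ N) ∣ (a m - + 1)) × ((+ N) ∣ c m) × ((+ N) ∣ (d m - + 1))

-- membership in g⁻¹ Γ₁(N) g  (i.e. g γ g⁻¹ ∈ Γ₁(N))
InConjΓ₁ : ℕ → M2 → M2 → Set
InConjΓ₁ N g γ = InΓ₁ N (g ⊗ γ ⊗ inv g)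

InH : ℕ → M2 → M2 → Set
InH N g γ = InΓ₁ N γ × InConjΓ₁ N g γ

n_g : (N : ℕ) → .{{NonZero N}} → M2 → ℕ
n_g N g = lcm (q ∣ a g * c g ∣) (q ∣ c g * c g ∣)
  where
  q : ℕ → ℕ
  q x = _/_ N (gcd N x) {{≢-nonZero (gcd[m,n]≢0 N x (inj₁ (≢-nonZero⁻¹ N)))}}

{-# OPTIONS --safe #-}
-- Modulo N, every γ ∈ Γ₁(N) is congruent to U y = (1 y ; 0 1) for some y, every
-- δ ∈ Γ(N) to the identity, and congruence is compatible with products.  Hence
-- γ = T^y δ with δ = T^(-y) γ ∈ Γ(N), and gγg⁻¹ is congruent to
--   g (U y) g⁻¹ = (1 - y ac   y a² ; -y c²   1 + y ac),
-- which lies in Γ₁(N) exactly when N ∣ y ac and N ∣ y c², i.e. when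
-- N / gcd(N, ac) and N / gcd(N, c²) both divide y, i.e. when n_g ∣ y.
module Submission where

open import Defs
open import Data.Nat using (ℕ; NonZero)
open import Data.Integer using (ℤ; +_; _*_)
open import Data.Product using (_×_; ∃-syntax)
open import Function.Bundles using (_⇔_)
open import Relation.Binary.PropositionalEquality using (_≡_)

import Data.Nat as ℕ
import Data.Nat.Properties as ℕ
import Data.Nat.Divisibility as ℕ
open import Data.Nat.GCD using (gcd; gcd[m,n]∣m; gcd[m,n]∣n; gcd[m,n]≢0)
open import Data.Nat.LCM using (lcm; lcm-least; m∣lcm[m,n]; n∣lcm[m,n])
open import Data.Nat.DivMod using (_/_; m/n*n≡m)
open import Data.Nat.Coprimality using (coprime-/gcd; coprime-divisor)
import Data.Integer as ℤ
open import Data.Integer using (_+_; _-_; -_; 0ℤ)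
open import Data.Integer.Properties using (abs-*; ∣-i∣≡∣i∣; +-inverseʳ; +-inverseˡ; *-comm)
open import Data.Integer.Divisibility.Signed
  using (_∣_; divides; ∣ᵤ⇒∣; ∣⇒∣ᵤ; ∣-refl; ∣-trans; ∣m⇒∣-m; ∣m∣n⇒∣m+n; ∣n⇒∣m*n; ∣m⇒∣m*n)
open import Data.Integer.Tactic.RingSolver using (solve-∀)
open import Data.Product using (_,_; proj₁)
open import Data.Product.Function.NonDependent.Propositional using (_×-⇔_)
open import Data.Sum using (inj₁)
open import Function.Bundles using (mk⇔; Equivalence)
import Function.Properties.Equivalence as ⇔
open import Relation.Binary.PropositionalEquality
  using (refl; sym; trans; cong; cong₂; subst; subst₂; module ≡-Reasoning)

open Equivalence using (to; from)

gcd-nonZeroˡ : ∀ n m .{{_ : NonZero n}} → NonZero (gcd n m)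
gcd-nonZeroˡ n m = ℕ.≢-nonZero (gcd[m,n]≢0 n m (inj₁ (ℕ.≢-nonZero⁻¹ n)))

_/gcd_ : (n : ℕ) .{{_ : NonZero n}} → ℕ → ℕ
n /gcd m = (n / gcd n m) {{gcd-nonZeroˡ n m}}

∣*⇔/gcd∣ : ∀ n .{{_ : NonZero n}} m o → n ℕ.∣ o ℕ.* m ⇔ n /gcd m ℕ.∣ o
∣*⇔/gcd∣ n m o = mk⇔ n∣o*m⇒n/k∣o n/k∣o⇒n∣o*m
  where
  instance
    _ : NonZero (gcd n m)
    _ = gcd-nonZeroˡ n m

  k : ℕ
  k = gcd n m

  n/k*k≡n : n /gcd m ℕ.* k ≡ n
  n/k*k≡n = m/n*n≡m (gcd[m,n]∣m n m)

  o*m≡m/k*o*k : o ℕ.* m ≡ m / k ℕ.* o ℕ.* k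
  o*m≡m/k*o*k = begin
    o ℕ.* m             ≡⟨ cong (o ℕ.*_) (sym (m/n*n≡m (gcd[m,n]∣n n m))) ⟩
    o ℕ.* (m / k ℕ.* k) ≡⟨ sym (ℕ.*-assoc o (m / k) k) ⟩
    o ℕ.* (m / k) ℕ.* k ≡⟨ cong (ℕ._* k) (ℕ.*-comm o (m / k)) ⟩
    m / k ℕ.* o ℕ.* k   ∎
    where open ≡-Reasoning

  -- after cancelling gcd n m, the cofactors n / gcd n m and m / gcd n m are coprime
  n∣o*m⇒n/k∣o : n ℕ.∣ o ℕ.* m → n /gcd m ℕ.∣ o
  n∣o*m⇒n/k∣o n∣o*m = coprime-divisor (coprime-/gcd n m)
    (ℕ.*-cancelʳ-∣ k (subst₂ ℕ._∣_ (sym n/k*k≡n) o*m≡m/k*o*k n∣o*m))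

  n/k∣o⇒n∣o*m : n /gcd m ℕ.∣ o → n ℕ.∣ o ℕ.* m
  n/k∣o⇒n∣o*m n/k∣o = subst (ℕ._∣ o ℕ.* m) n/k*k≡n (ℕ.*-pres-∣ n/k∣o (gcd[m,n]∣n n m))

+∣*⇔/gcd∣ : ∀ n .{{_ : NonZero n}} m y → + n ∣ y * m ⇔ + (n /gcd ℤ.∣ m ∣) ∣ y
+∣*⇔/gcd∣ n m y = mk⇔
  (λ n∣y*m → ∣ᵤ⇒∣ (to abs⇔ (subst (n ℕ.∣_) (abs-* y m) (∣⇒∣ᵤ n∣y*m))))
  (λ n/gcd∣y → ∣ᵤ⇒∣ (subst (n ℕ.∣_) (sym (abs-* y m)) (from abs⇔ (∣⇒∣ᵤ n/gcd∣y))))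
  where
  abs⇔ : n ℕ.∣ ℤ.∣ y ∣ ℕ.* ℤ.∣ m ∣ ⇔ n /gcd ℤ.∣ m ∣ ℕ.∣ ℤ.∣ y ∣
  abs⇔ = ∣*⇔/gcd∣ n ℤ.∣ m ∣ ℤ.∣ y ∣

+lcm∣⇔ : ∀ k l y → (+ k ∣ y × + l ∣ y) ⇔ + lcm k l ∣ y
+lcm∣⇔ k l y = mk⇔
  (λ (k∣y , l∣y) → ∣ᵤ⇒∣ (lcm-least (∣⇒∣ᵤ k∣y) (∣⇒∣ᵤ l∣y)))
  (λ lcm∣y → ∣-trans (∣ᵤ⇒∣ (m∣lcm[m,n] k l)) lcm∣y , ∣-trans (∣ᵤ⇒∣ (n∣lcm[m,n] k l)) lcm∣y)

n_g∣⇔ : ∀ N .{{_ : NonZero N}} g y →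
        (+ N ∣ y * (a g * c g) × + N ∣ y * (c g * c g)) ⇔ + n_g N g ∣ y
n_g∣⇔ N g y = ⇔.trans (+∣*⇔/gcd∣ N (a g * c g) y ×-⇔ +∣*⇔/gcd∣ N (c g * c g) y)
                      (+lcm∣⇔ (N /gcd ℤ.∣ a g * c g ∣) (N /gcd ℤ.∣ c g * c g ∣) y)

mat-cong : ∀ {a b c d a′ b′ c′ d′} → a ≡ a′ → b ≡ b′ → c ≡ c′ → d ≡ d′ →
           mat a b c d ≡ mat a′ b′ c′ d′
mat-cong refl refl refl refl = refl

⊗-assoc : ∀ A B C → A ⊗ B ⊗ C ≡ A ⊗ (B ⊗ C)
⊗-assoc (mat a b c d) (mat e f g h) (mat i j k l) =
  mat-cong (entry a b e f g h i k) (entry a b e f g h j l)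
           (entry c d e f g h i k) (entry c d e f g h j l)
  where
  entry : ∀ a b e f g h i k →
          (a * e + b * g) * i + (a * f + b * h) * k ≡ a * (e * i + f * k) + b * (g * i + h * k)
  entry = solve-∀

⊗-identityˡ : ∀ A → I₂ ⊗ A ≡ A
⊗-identityˡ (mat a b c d) = mat-cong (entry a c) (entry b d) (entry′ a c) (entry′ b d)
  where
  entry : ∀ x y → + 1 * x + + 0 * y ≡ x
  entry = solve-∀
  entry′ : ∀ x y → + 0 * x + + 1 * y ≡ y
  entry′ = solve-∀

⊗-identityʳ : ∀ A → A ⊗ I₂ ≡ A
⊗-identityʳ (mat a b c d) = mat-cong (entry a b) (entry′ a b) (entry c d) (entry′ c d)
  where
  entry : ∀ x y → x * + 1 + y * + 0 ≡ x
  entry = solve-∀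
  entry′ : ∀ x y → x * + 0 + y * + 1 ≡ y
  entry′ = solve-∀

det-⊗ : ∀ A B → det (A ⊗ B) ≡ det A * det B
det-⊗ (mat a b c d) (mat e f g h) = identity a b c d e f g h
  where
  identity : ∀ a b c d e f g h →
             (a * e + b * g) * (c * f + d * h) - (a * f + b * h) * (c * e + d * g)
               ≡ (a * d - b * c) * (e * h - f * g)
  identity = solve-∀

SL2-⊗ : ∀ A B → SL2 A → SL2 B → SL2 (A ⊗ B)
SL2-⊗ A B detA≡1 detB≡1 = begin
  det (A ⊗ B)   ≡⟨ det-⊗ A B ⟩
  det A * det B ≡⟨ cong₂ _*_ detA≡1 detB≡1 ⟩
  + 1           ∎
  where open ≡-Reasoning

SL2-inv : ∀ A → SL2 A → SL2 (inv A)
SL2-inv (mat a b c d) = trans (identity a b c d)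
  where
  identity : ∀ a b c d → d * a - (- b) * (- c) ≡ a * d - b * c
  identity = solve-∀

U : ℤ → M2
U x = mat (+ 1) x (+ 0) (+ 1)

SL2-U : ∀ x → SL2 (U x)
SL2-U x = identity x
  where
  identity : ∀ x → + 1 * + 1 - x * + 0 ≡ + 1
  identity = solve-∀

U-+ : ∀ x y → U x ⊗ U y ≡ U (x + y)
U-+ x y = mat-cong (entry₁ x) (entry₂ x y) refl (entry₄ y)
  where
  entry₁ : ∀ x → + 1 * + 1 + x * + 0 ≡ + 1
  entry₁ = solve-∀
  entry₂ : ∀ x y → + 1 * y + x * + 1 ≡ x + y
  entry₂ = solve-∀
  entry₄ : ∀ y → + 0 * y + + 1 * + 1 ≡ + 1
  entry₄ = solve-∀

T^≡U : ∀ k → T^ k ≡ U k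
T^≡U (+ n) = pow-T n
  where
  pow-T : ∀ n → pow T n ≡ U (+ n)
  pow-T ℕ.zero    = refl
  pow-T (ℕ.suc n) = trans (cong (T ⊗_) (pow-T n)) (U-+ (+ 1) (+ n))
T^≡U ℤ.-[1+ n ] = pow-T⁻¹ n
  where
  pow-T⁻¹ : ∀ n → pow T⁻¹ (ℕ.suc n) ≡ U ℤ.-[1+ n ]
  pow-T⁻¹ ℕ.zero    = ⊗-identityʳ T⁻¹
  pow-T⁻¹ (ℕ.suc n) = trans (cong (T⁻¹ ⊗_) (pow-T⁻¹ n)) (U-+ (- + 1) ℤ.-[1+ n ])

U-conj : ∀ g → SL2 g → ∀ y → g ⊗ U y ⊗ inv g
  ≡ mat (+ 1 - y * (a g * c g)) (y * (a g * a g)) (- (y * (c g * c g))) (+ 1 + y * (a g * c g))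
U-conj (mat a b c d) det≡1 y = mat-cong
  (trans (entry₁ a b c d y) (cong (_- y * (a * c)) det≡1))
  (entry₂ a b c d y) (entry₃ a b c d y)
  (trans (entry₄ a b c d y) (cong (_+ y * (a * c)) det≡1))
  where
  entry₁ : ∀ a b c d y → (a * + 1 + b * + 0) * d + (a * y + b * + 1) * (- c)
                         ≡ (a * d - b * c) - y * (a * c)
  entry₁ = solve-∀
  entry₂ : ∀ a b c d y → (a * + 1 + b * + 0) * (- b) + (a * y + b * + 1) * a ≡ y * (a * a)
  entry₂ = solve-∀
  entry₃ : ∀ a b c d y → (c * + 1 + d * + 0) * d + (c * y + d * + 1) * (- c) ≡ - (y * (c * c))
  entry₃ = solve-∀
  entry₄ : ∀ a b c d y → (c * + 1 + d * + 0) * (- b) + (c * y + d * + 1) * a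
                         ≡ (a * d - b * c) + y * (a * c)
  entry₄ = solve-∀

module Congruence (N : ℕ) where

  infix 4 _≈_ _≋_

  record _≈_ (x y : ℤ) : Set where
    constructor ≈-intro
    field N∣x-y : + N ∣ x - y

  private
    ∣-cong : ∀ {x y} → x ≡ y → + N ∣ x → + N ∣ y
    ∣-cong = subst (+ N ∣_)

  ≈-reflexive : ∀ {x y} → x ≡ y → x ≈ y
  ≈-reflexive {x} refl = ≈-intro (∣-cong (sym (+-inverseʳ x)) (divides 0ℤ refl))

  ≈-refl : ∀ {x} → x ≈ x
  ≈-refl = ≈-reflexive refl

  ≈-sym : ∀ {x y} → x ≈ y → y ≈ x
  ≈-sym {x} {y} (≈-intro p) = ≈-intro (∣-cong (identity x y) (∣m⇒∣-m p))
    where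
    identity : ∀ x y → - (x - y) ≡ y - x
    identity = solve-∀

  ≈-trans : ∀ {x y z} → x ≈ y → y ≈ z → x ≈ z
  ≈-trans {x} {y} {z} (≈-intro p) (≈-intro q) =
    ≈-intro (∣-cong (identity x y z) (∣m∣n⇒∣m+n p q))
    where
    identity : ∀ x y z → (x - y) + (y - z) ≡ x - z
    identity = solve-∀

  +-cong : ∀ {x y u v} → x ≈ y → u ≈ v → x + u ≈ y + v
  +-cong {x} {y} {u} {v} (≈-intro p) (≈-intro q) =
    ≈-intro (∣-cong (identity x y u v) (∣m∣n⇒∣m+n p q))
    where
    identity : ∀ x y u v → (x - y) + (u - v) ≡ (x + u) - (y + v)
    identity = solve-∀

  *-cong : ∀ {x y u v} → x ≈ y → u ≈ v → x * u ≈ y * v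
  *-cong {x} {y} {u} {v} (≈-intro p) (≈-intro q) =
    ≈-intro (∣-cong (identity x y u v) (∣m∣n⇒∣m+n (∣n⇒∣m*n x q) (∣m⇒∣m*n v p)))
    where
    identity : ∀ x y u v → x * (u - v) + (x - y) * v ≡ x * u - y * v
    identity = solve-∀

  ≈0⇔∣ : ∀ {x} → x ≈ 0ℤ ⇔ + N ∣ x
  ≈0⇔∣ {x} = mk⇔
    (λ (≈-intro p) → ∣-cong (identity x) p) (λ p → ≈-intro (∣-cong (sym (identity x)) p))
    where
    identity : ∀ x → x - 0ℤ ≡ x
    identity = solve-∀

  x+y≈x⇔∣y : ∀ {x y} → x + y ≈ x ⇔ + N ∣ y
  x+y≈x⇔∣y {x} {y} = mk⇔
    (λ (≈-intro p) → ∣-cong (identity x y) p) (λ p → ≈-intro (∣-cong (sym (identity x y)) p))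
    where
    identity : ∀ x y → (x + y) - x ≡ y
    identity = solve-∀

  ∣-⇔∣ : ∀ {y} → + N ∣ - y ⇔ + N ∣ y
  ∣-⇔∣ {y} = mk⇔ (λ p → ∣ᵤ⇒∣ (subst (N ℕ.∣_) (∣-i∣≡∣i∣ y) (∣⇒∣ᵤ p))) ∣m⇒∣-m

  record _≋_ (A B : M2) : Set where
    constructor ≋-intro
    field
      a≈ : a A ≈ a B
      b≈ : b A ≈ b B
      c≈ : c A ≈ c B
      d≈ : d A ≈ d B

  ≋-reflexive : ∀ {A B} → A ≡ B → A ≋ B
  ≋-reflexive refl = ≋-intro ≈-refl ≈-refl ≈-refl ≈-refl

  ≋-refl : ∀ {A} → A ≋ A
  ≋-refl = ≋-reflexive refl

  ≋-sym : ∀ {A B} → A ≋ B → B ≋ A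
  ≋-sym (≋-intro p q r s) = ≋-intro (≈-sym p) (≈-sym q) (≈-sym r) (≈-sym s)

  ≋-trans : ∀ {A B C} → A ≋ B → B ≋ C → A ≋ C
  ≋-trans (≋-intro p q r s) (≋-intro p′ q′ r′ s′) =
    ≋-intro (≈-trans p p′) (≈-trans q q′) (≈-trans r r′) (≈-trans s s′)

  ⊗-cong : ∀ {A A′ B B′} → A ≋ A′ → B ≋ B′ → A ⊗ B ≋ A′ ⊗ B′
  ⊗-cong (≋-intro a≈₁ b≈₁ c≈₁ d≈₁) (≋-intro a≈₂ b≈₂ c≈₂ d≈₂) = ≋-intro
    (+-cong (*-cong a≈₁ a≈₂) (*-cong b≈₁ c≈₂)) (+-cong (*-cong a≈₁ b≈₂) (*-cong b≈₁ d≈₂))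
    (+-cong (*-cong c≈₁ a≈₂) (*-cong d≈₁ c≈₂)) (+-cong (*-cong c≈₁ b≈₂) (*-cong d≈₁ d≈₂))

  InΓ₁⇔≋U : ∀ A → InΓ₁ N A ⇔ (SL2 A × ∃[ x ] A ≋ U x)
  InΓ₁⇔≋U A = mk⇔
    (λ (detA≡1 , N∣a-1 , N∣c , N∣d-1) →
       detA≡1 , b A , ≋-intro (≈-intro (∣ᵤ⇒∣ N∣a-1)) ≈-refl
                              (from ≈0⇔∣ (∣ᵤ⇒∣ N∣c)) (≈-intro (∣ᵤ⇒∣ N∣d-1)))
    (λ (detA≡1 , _ , ≋-intro (≈-intro N∣a-1) _ c≈0 (≈-intro N∣d-1)) →
       detA≡1 , ∣⇒∣ᵤ N∣a-1 , ∣⇒∣ᵤ (to ≈0⇔∣ c≈0) , ∣⇒∣ᵤ N∣d-1)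

  InΓ⇔≋I : ∀ A → InΓ N A ⇔ (SL2 A × A ≋ I₂)
  InΓ⇔≋I A = mk⇔
    (λ (detA≡1 , N∣a-1 , N∣b , N∣c , N∣d-1) →
       detA≡1 , ≋-intro (≈-intro (∣ᵤ⇒∣ N∣a-1)) (from ≈0⇔∣ (∣ᵤ⇒∣ N∣b))
                        (from ≈0⇔∣ (∣ᵤ⇒∣ N∣c)) (≈-intro (∣ᵤ⇒∣ N∣d-1)))
    (λ (detA≡1 , ≋-intro (≈-intro N∣a-1) b≈0 c≈0 (≈-intro N∣d-1)) →
       detA≡1 , ∣⇒∣ᵤ N∣a-1 , ∣⇒∣ᵤ (to ≈0⇔∣ b≈0) , ∣⇒∣ᵤ (to ≈0⇔∣ c≈0) , ∣⇒∣ᵤ N∣d-1)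

  T^⊗Γ⇒≋U : ∀ {γ k δ} → InΓ N δ → γ ≡ T^ k ⊗ δ → SL2 γ × γ ≋ U k
  T^⊗Γ⇒≋U {k = k} {δ} δ∈Γ refl =
    let (detδ≡1 , δ≋I) = to (InΓ⇔≋I δ) δ∈Γ in
    subst (λ X → SL2 (X ⊗ δ) × X ⊗ δ ≋ U k) (sym (T^≡U k))
      (SL2-⊗ (U k) δ (SL2-U k) detδ≡1 ,
       ≋-trans (⊗-cong (≋-refl {U k}) δ≋I) (≋-reflexive (⊗-identityʳ (U k))))

  ≋U⇒T^⊗Γ : ∀ {γ k} → SL2 γ → γ ≋ U k → ∃[ δ ] (InΓ N δ × γ ≡ T^ k ⊗ δ)
  ≋U⇒T^⊗Γ {γ} {k} detγ≡1 γ≋Uk =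
    U (- k) ⊗ γ ,
    from (InΓ⇔≋I (U (- k) ⊗ γ)) (SL2-⊗ (U (- k)) γ (SL2-U (- k)) detγ≡1 , δ≋I) ,
    γ≡T^k⊗δ
    where
    δ≋I : U (- k) ⊗ γ ≋ I₂
    δ≋I = ≋-trans (⊗-cong (≋-refl {U (- k)}) γ≋Uk)
                  (≋-reflexive (trans (U-+ (- k) k) (cong U (+-inverseˡ k))))

    γ≡T^k⊗δ : γ ≡ T^ k ⊗ (U (- k) ⊗ γ)
    γ≡T^k⊗δ = begin
      γ                    ≡⟨ sym (⊗-identityˡ γ) ⟩
      U 0ℤ ⊗ γ             ≡⟨ cong (λ x → U x ⊗ γ) (sym (+-inverseʳ k)) ⟩
      U (k - k) ⊗ γ        ≡⟨ cong (_⊗ γ) (sym (U-+ k (- k))) ⟩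
      U k ⊗ U (- k) ⊗ γ    ≡⟨ ⊗-assoc (U k) (U (- k)) γ ⟩
      U k ⊗ (U (- k) ⊗ γ)  ≡⟨ cong (_⊗ (U (- k) ⊗ γ)) (sym (T^≡U k)) ⟩
      T^ k ⊗ (U (- k) ⊗ γ) ∎
      where open ≡-Reasoning

  ≋U⇒T^nℤΓ : ∀ {γ x} n → SL2 γ → γ ≋ U x → + n ∣ x →
             ∃[ k ] ∃[ δ ] (InΓ N δ × γ ≡ T^ (+ n * k) ⊗ δ)
  ≋U⇒T^nℤΓ {γ} n detγ≡1 γ≋Ux (divides k x≡k*n) =
    k , ≋U⇒T^⊗Γ detγ≡1 (subst (λ z → γ ≋ U z) (trans x≡k*n (*-comm k (+ n))) γ≋Ux)

  InΓ₁⇔T^ℤΓ : ∀ γ → InΓ₁ N γ ⇔ (∃[ k ] ∃[ δ ] (InΓ N δ × γ ≡ T^ k ⊗ δ))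
  InΓ₁⇔T^ℤΓ γ = mk⇔
    (λ γ∈Γ₁ → let (detγ≡1 , k , γ≋Uk) = to (InΓ₁⇔≋U γ) γ∈Γ₁ in k , ≋U⇒T^⊗Γ detγ≡1 γ≋Uk)
    (λ (k , δ , δ∈Γ , γ≡T^k⊗δ) →
       let (detγ≡1 , γ≋Uk) = T^⊗Γ⇒≋U δ∈Γ γ≡T^k⊗δ in from (InΓ₁⇔≋U γ) (detγ≡1 , k , γ≋Uk))

module Conjugation (N : ℕ) .{{_ : NonZero N}} (g : M2) (detg≡1 : SL2 g) where
  open Congruence N

  conj-cong : ∀ {γ γ′} → γ ≋ γ′ → g ⊗ γ ⊗ inv g ≋ g ⊗ γ′ ⊗ inv g
  conj-cong γ≋γ′ = ⊗-cong (⊗-cong (≋-refl {g}) γ≋γ′) (≋-refl {inv g})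

  SL2-conj : ∀ γ → SL2 γ → SL2 (g ⊗ γ ⊗ inv g)
  SL2-conj γ detγ≡1 = SL2-⊗ (g ⊗ γ) (inv g) (SL2-⊗ g γ detg≡1 detγ≡1) (SL2-inv g detg≡1)

  U-conj≋U⇔ : ∀ y → (∃[ x ] g ⊗ U y ⊗ inv g ≋ U x)
                    ⇔ (+ N ∣ y * (a g * c g) × + N ∣ y * (c g * c g))
  U-conj≋U⇔ y = mk⇔
    (λ (x , conjU≋Ux) →
       let ≋-intro a≈1 _ c≈0 _ = ≋-trans (≋-reflexive (sym (U-conj g detg≡1 y))) conjU≋Ux
       in to ∣-⇔∣ (to x+y≈x⇔∣y a≈1) , to ∣-⇔∣ (to ≈0⇔∣ c≈0))
    (λ (N∣y*ac , N∣y*cc) → y * (a g * a g) , ≋-trans (≋-reflexive (U-conj g detg≡1 y))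
       (≋-intro (from x+y≈x⇔∣y (from ∣-⇔∣ N∣y*ac)) ≈-refl
                (from ≈0⇔∣ (from ∣-⇔∣ N∣y*cc)) (from x+y≈x⇔∣y N∣y*ac)))

  InConjΓ₁⇔ : ∀ {γ y} → SL2 γ → γ ≋ U y →
              InConjΓ₁ N g γ ⇔ (+ N ∣ y * (a g * c g) × + N ∣ y * (c g * c g))
  InConjΓ₁⇔ {γ} {y} detγ≡1 γ≋Uy = mk⇔
    (λ conj∈Γ₁ → let (_ , x , conj≋Ux) = to (InΓ₁⇔≋U (g ⊗ γ ⊗ inv g)) conj∈Γ₁ in
       to (U-conj≋U⇔ y) (x , ≋-trans (conj-cong (≋-sym γ≋Uy)) conj≋Ux))
    (λ N∣y*ac×N∣y*cc → let (x , conjU≋Ux) = from (U-conj≋U⇔ y) N∣y*ac×N∣y*cc in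
       from (InΓ₁⇔≋U (g ⊗ γ ⊗ inv g))
            (SL2-conj γ detγ≡1 , x , ≋-trans (conj-cong γ≋Uy) conjU≋Ux))

  InH⇔n_g∣ : ∀ {γ y} → SL2 γ → γ ≋ U y → InH N g γ ⇔ + n_g N g ∣ y
  InH⇔n_g∣ {γ} {y} detγ≡1 γ≋Uy = mk⇔
    (λ (_ , conj∈Γ₁) → to (n_g∣⇔ N g y) (to (InConjΓ₁⇔ detγ≡1 γ≋Uy) conj∈Γ₁))
    (λ n_g∣y → from (InΓ₁⇔≋U γ) (detγ≡1 , y , γ≋Uy) ,
               from (InConjΓ₁⇔ detγ≡1 γ≋Uy) (from (n_g∣⇔ N g y) n_g∣y))

  Γ⊆H : ∀ δ → InΓ N δ → InH N g δ
  Γ⊆H δ δ∈Γ =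
    let (detδ≡1 , δ≋I) = to (InΓ⇔≋I δ) δ∈Γ in from (InH⇔n_g∣ detδ≡1 δ≋I) (divides 0ℤ refl)

  InH-⊗-InΓ : ∀ {h δ} → InH N g h → InΓ N δ → InH N g (h ⊗ δ)
  InH-⊗-InΓ {h} {δ} h∈H δ∈Γ =
    let (deth≡1 , x , h≋Ux) = to (InΓ₁⇔≋U h) (proj₁ h∈H)
        (detδ≡1 , δ≋I)      = to (InΓ⇔≋I δ) δ∈Γ
        h⊗δ≋Ux              = ≋-trans (⊗-cong (≋-refl {h}) δ≋I)
                                      (≋-trans (≋-reflexive (⊗-identityʳ h)) h≋Ux)
    in from (InH⇔n_g∣ (SL2-⊗ h δ deth≡1 detδ≡1) h⊗δ≋Ux) (to (InH⇔n_g∣ deth≡1 h≋Ux) h∈H)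

  InH⇔H⊗Γ : ∀ γ → InH N g γ ⇔ (∃[ h ] ∃[ δ ] (InH N g h × InΓ N δ × γ ≡ h ⊗ δ))
  InH⇔H⊗Γ γ = mk⇔
    (λ γ∈H → γ , I₂ , γ∈H , from (InΓ⇔≋I I₂) (SL2-U 0ℤ , ≋-refl) , sym (⊗-identityʳ γ))
    (λ { (h , δ , h∈H , δ∈Γ , refl) → InH-⊗-InΓ h∈H δ∈Γ })

  InH⇔T^n_gℤΓ : ∀ γ → InH N g γ ⇔ (∃[ k ] ∃[ δ ] (InΓ N δ × γ ≡ T^ (+ n_g N g * k) ⊗ δ))
  InH⇔T^n_gℤΓ γ = mk⇔
    (λ γ∈H → let (detγ≡1 , x , γ≋Ux) = to (InΓ₁⇔≋U γ) (proj₁ γ∈H) in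
       ≋U⇒T^nℤΓ (n_g N g) detγ≡1 γ≋Ux (to (InH⇔n_g∣ detγ≡1 γ≋Ux) γ∈H))
    (λ (k , δ , δ∈Γ , γ≡T^⊗δ) →
       let (detγ≡1 , γ≋U) = T^⊗Γ⇒≋U {k = + n_g N g * k} δ∈Γ γ≡T^⊗δ
       in from (InH⇔n_g∣ detγ≡1 γ≋U) (∣m⇒∣m*n k ∣-refl))

lemma3p2 : (N : ℕ) .{{_ : NonZero N}} (g : M2) → SL2 g →
    -- Γ(N) ⊆ Γ₁(N) ∩ g⁻¹Γ₁(N)g, so the quotients by Γ(N) make sense
    ((δ : M2) → InΓ N δ → InH N g δ)
    -- Γ₁/H ≅ (Γ₁/Γ(N))/(H/Γ(N)) : the two coset relations on Γ₁ coincide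
    × ((γ γ′ : M2) → InΓ₁ N γ → InΓ₁ N γ′ →
        (InH N g (inv γ ⊗ γ′)
          ⇔ (∃[ h ] ∃[ δ ] (InH N g h × InΓ N δ × (inv γ ⊗ γ′ ≡ h ⊗ δ)))))
    -- Γ₁(N)/Γ(N) = T^ℤ Γ(N)
    × ((γ : M2) → InΓ₁ N γ ⇔ (∃[ k ] ∃[ δ ] (InΓ N δ × (γ ≡ T^ k ⊗ δ))))
    -- (Γ₁(N) ∩ g⁻¹Γ₁(N)g)/Γ(N) = T^(n_g ℤ) Γ(N)
    × ((γ : M2) → InH N g γ
        ⇔ (∃[ k ] ∃[ δ ] (InΓ N δ × (γ ≡ T^ (+ n_g N g * k) ⊗ δ))))
-- the coset description of H holds for every matrix
lemma3p2 N g detg≡1 =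
  Γ⊆H , (λ γ γ′ _ _ → InH⇔H⊗Γ (inv γ ⊗ γ′)) , InΓ₁⇔T^ℤΓ , InH⇔T^n_gℤΓ
  where
  open Congruence N using (InΓ₁⇔T^ℤΓ)
  open Conjugation N g detg≡1
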